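{- Let $s,n$ be positive integers with $1\le s\le n$. Let $\mathbf{j}=(j_1,\dots,j_s)$ be an $s$-tuple of distinct elements of $\{1,\dots,n\}$, and let $\mathcal{D}(\mathbf{j})=\{(j_1,j_2),(j_2,j_3),\dots,(j_{s-1},j_s)\}$ (empty if $s=1$). Then $$K_{j_1}K_{j_2}\cdots K_{j_s}=\mathrm{Id}-\sum_{j\in\mathbf{j}}\mathbf{e}_j\mathbf{e}_j^T+\sum_{(j,\ell)\in\mathcal{D}(\mathbf{j})}(-1)^{j+\ell}\mathbf{e}_j\mathbf{e}_\ell^T+\mathbf{e}_{j_s}\mathbf{r}_{j_s}.$$ Here the first sum runs over the components $j_1,\dots,j_s$ of $\mathbf{j}$.
   Context: For a positive integer $n$: - $\mathbf{e}_j$ is the $j$-th standard basis column vector of $\mathbb{Z}^n$; - $\mathbf{r}_j=\big((-1)^j,(-1)^{j+1},\dots,(-1)^{j+n-1}\big)$ is a row vector; - $K_j=\mathrm{Id}-\mathbf{e}_j\mathbf{e}_j^T+\mathbf{e}_j\mathbf{r}_j$ is the $n\times n$ identity matrix with row $j$ replaced by $\mathbf{r}_j$. -}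

module Defs where

open import Data.Nat as ℕ using (ℕ; zero; suc; _≤_; _<_; s≤s; z≤n)
open import Data.Fin using (Fin; zero; suc; toℕ; fromℕ<)
open import Data.Integer using (ℤ; +_; -_; _+_; _*_; _-_)
open import Relation.Nullary using (yes; no)
open import Relation.Binary.PropositionalEquality using (_≡_)
open import Data.Fin using (_≟_)

-- Matrices over ℤ, indexed by Fin n (index i : Fin n stands for i+1 in {1,…,n}).
Mat : ℕ → Set
Mat n = Fin n → Fin n → ℤ

pos : ∀ {n} → Fin n → ℕ
pos i = suc (toℕ i)

sgn : ℕ → ℤ
sgn zero    = + 1
sgn (suc m) = - sgn m

Σ : ∀ n → (Fin n → ℤ) → ℤ
Σ zero    f = + 0
Σ (suc n) f = f zero + Σ n (λ i → f (suc i))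

δ : ∀ {n} → Fin n → Fin n → ℤ
δ i j with i ≟ j
... | yes _ = + 1
... | no  _ = + 0

Id : ∀ {n} → Mat n
Id = δ

_⊕_ : ∀ {n} → Mat n → Mat n → Mat n
(A ⊕ B) i k = A i k + B i k

_⊖_ : ∀ {n} → Mat n → Mat n → Mat n
(A ⊖ B) i k = A i k - B i k

_·_ : ∀ {n} → Mat n → Mat n → Mat n
_·_ {n} A B i k = Σ n (λ m → A i m * B m k)

infixl 6 _⊕_ _⊖_
infixl 7 _·_

ΣM : ∀ {n} s → (Fin s → Mat n) → Mat n
ΣM s F i k = Σ s (λ a → F a i k)

ΠM : ∀ {n} s → (Fin s → Mat n) → Mat n
ΠM zero    F = Id
ΠM (suc s) F = F zero · ΠM s (λ a → F (suc a))

e : ∀ {n} → Fin n → Fin n → ℤ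
e j i = δ i j

-- r_j = ((-1)^j, (-1)^(j+1), …, (-1)^(j+n-1)) : entry at 1-based position c is (-1)^(j+c-1)
r : ∀ {n} → Fin n → Fin n → ℤ
r j c = sgn (pos j ℕ.+ toℕ c)

outer : ∀ {n} → (Fin n → ℤ) → (Fin n → ℤ) → Mat n
outer u v i k = u i * v k

K : ∀ {n} → Fin n → Mat n
K j = Id ⊖ outer (e j) (e j) ⊕ outer (e j) (r j)

succPos : ∀ {s} → Fin s → Fin s → ℤ
succPos a b with pos b ℕ.≟ suc (pos a)
... | yes _ = + 1
... | no  _ = + 0

Dsum : ∀ {n s} → (Fin s → Fin n) → Mat n
Dsum {n} {s} jj =
  ΣM s (λ a → ΣM s (λ b → λ i k →
    succPos a b * (sgn (pos (jj a) ℕ.+ pos (jj b)) * outer (e (jj a)) (e (jj b)) i k)))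

lastIx : ∀ s → 1 ≤ s → Fin s
lastIx (suc s) _ = fromℕ< (s<1+s s)
  where
  s<1+s : ∀ m → m < suc m
  s<1+s zero    = s≤s z≤n
  s<1+s (suc m) = s≤s (s<1+s m)

{-# OPTIONS --safe #-}
-- Induction on s, peeling off the first factor. For any matrix M,
-- K_j M = M - e_j (row j of M) + e_j (r_j M). Take M = K_{j_2}⋯K_{j_s} = Id + T.
-- Row j_1 of T vanishes since j_1 is none of j_2,…,j_s, and r_{j_1} T telescopes to
-- (-1)^{j_1+j_2} e_{j_2}^T - r_{j_1}, because r_j e_l = -(-1)^{j+l} and r_j e_l r_l = -r_j.
-- Hence K_{j_1} M = M - e_{j_1} e_{j_1}^T + (-1)^{j_1+j_2} e_{j_1} e_{j_2}^T.
module Submission where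

open import Defs
open import Data.Nat using (ℕ; _≤_)
open import Data.Fin using (Fin)
open import Function.Definitions using (Injective)
open import Relation.Binary.PropositionalEquality using (_≡_)

open import Data.Nat as ℕ using (zero; suc; s≤s; z≤n)
open import Data.Nat.Properties using (+-suc) renaming (suc-injective to ℕ-suc-injective)
open import Data.Fin using (zero; suc; _≟_)
open import Data.Fin.Properties using (suc-injective; 0≢1+n)
open import Data.Integer using (ℤ; +_; -_; _+_; _*_; _-_; -1ℤ)
open import Data.Integer.Properties
  using (+-*-semiring; +-identityˡ; +-identityʳ; *-identityˡ; *-comm; *-assoc;
         *-distribʳ-+; *-distribˡ-+; -1*i≡-i; neg-involutive; neg-distribˡ-*)
open import Data.Integer.Tactic.RingSolver using (solve-∀)
open import Algebra.Properties.Semiring.Sum +-*-semiring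
  using (sum; ∑-distrib-+; *-distribˡ-sum; sum-replicate-zero)
open import Function using (_∘_)
open import Relation.Binary.PropositionalEquality
  using (refl; sym; trans; cong; cong₂; _≢_; _≗_; module ≡-Reasoning)
open import Relation.Nullary using (Dec; yes; no)
open import Data.Empty using (⊥-elim)
open ≡-Reasoning

δ-≡ : ∀ {n} {i j : Fin n} → i ≡ j → δ i j ≡ + 1
δ-≡ {i = i} {j} i≡j with i ≟ j
... | yes _   = refl
... | no  i≢j = ⊥-elim (i≢j i≡j)

δ-≢ : ∀ {n} {i j : Fin n} → i ≢ j → δ i j ≡ + 0
δ-≢ {i = i} {j} i≢j with i ≟ j
... | yes i≡j = ⊥-elim (i≢j i≡j)
... | no  _   = refl

δ-sym : ∀ {n} (i j : Fin n) → δ i j ≡ δ j i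
δ-sym i j with i ≟ j
... | yes i≡j = sym (δ-≡ (sym i≡j))
... | no  i≢j = sym (δ-≢ (i≢j ∘ sym))

δ-suc : ∀ {n} (i j : Fin n) → δ (suc i) (suc j) ≡ δ i j
δ-suc i j with i ≟ j
... | yes _ = refl
... | no  _ = refl

Σ≡sum : ∀ n (f : Fin n → ℤ) → Σ n f ≡ sum f
Σ≡sum zero    f = refl
Σ≡sum (suc n) f = cong (_+_ (f zero)) (Σ≡sum n (f ∘ suc))

Σ-cong : ∀ n {f g : Fin n → ℤ} → f ≗ g → Σ n f ≡ Σ n g
Σ-cong zero    f≗g = refl
Σ-cong (suc n) f≗g = cong₂ _+_ (f≗g zero) (Σ-cong n (f≗g ∘ suc))

Σ-zero : ∀ n → Σ n (λ _ → + 0) ≡ + 0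
Σ-zero n = trans (Σ≡sum n _) (sum-replicate-zero n)

Σ-distrib-+ : ∀ n (f g : Fin n → ℤ) → Σ n (λ i → f i + g i) ≡ Σ n f + Σ n g
Σ-distrib-+ n f g
  rewrite Σ≡sum n (λ i → f i + g i) | Σ≡sum n f | Σ≡sum n g = ∑-distrib-+ f g

Σ-*ˡ : ∀ n x (f : Fin n → ℤ) → Σ n (λ i → x * f i) ≡ x * Σ n f
Σ-*ˡ n x f rewrite Σ≡sum n (λ i → x * f i) | Σ≡sum n f = sym (*-distribˡ-sum x f)

Σ-neg : ∀ n (f : Fin n → ℤ) → Σ n (λ i → - f i) ≡ - Σ n f
Σ-neg n f = begin
  Σ n (λ i → - f i)      ≡⟨ Σ-cong n (λ i → sym (-1*i≡-i (f i))) ⟩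
  Σ n (λ i → -1ℤ * f i)  ≡⟨ Σ-*ˡ n -1ℤ f ⟩
  -1ℤ * Σ n f            ≡⟨ -1*i≡-i (Σ n f) ⟩
  - Σ n f                ∎

Σ-distrib-- : ∀ n (f g : Fin n → ℤ) → Σ n (λ i → f i - g i) ≡ Σ n f - Σ n g
Σ-distrib-- n f g = trans (Σ-distrib-+ n f (λ i → - g i)) (cong (_+_ (Σ n f)) (Σ-neg n g))

Σ-δ : ∀ n (j : Fin n) (f : Fin n → ℤ) → Σ n (λ m → δ m j * f m) ≡ f j
Σ-δ (suc n) zero f = begin
  + 1 * f zero + Σ n (λ _ → + 0)  ≡⟨ cong₂ _+_ (*-identityˡ (f zero)) (Σ-zero n) ⟩
  f zero + + 0                    ≡⟨ +-identityʳ (f zero) ⟩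
  f zero                          ∎
Σ-δ (suc n) (suc j) f = begin
  + 0 + Σ n (λ m → δ (suc m) (suc j) * f (suc m))  ≡⟨ +-identityˡ _ ⟩
  Σ n (λ m → δ (suc m) (suc j) * f (suc m))        ≡⟨ Σ-cong n (λ m → cong (_* f (suc m)) (δ-suc m j)) ⟩
  Σ n (λ m → δ m j * f (suc m))                    ≡⟨ Σ-δ n j (f ∘ suc) ⟩
  f (suc j)                                        ∎

infix 4 _≋_
_≋_ : ∀ {n} → Mat n → Mat n → Set
A ≋ B = ∀ i k → A i k ≡ B i k

infixl 7 _·ᵣ_
_·ᵣ_ : ∀ {n} → (Fin n → ℤ) → Mat n → Fin n → ℤ
_·ᵣ_ {n} v M k = Σ n (λ m → v m * M m k)

·-congˡ : ∀ {n} (A : Mat n) {M N : Mat n} → M ≋ N → A · M ≋ A · N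
·-congˡ {n} A M≋N i k = Σ-cong n (λ m → cong (A i m *_) (M≋N m k))

·-distribʳ-⊕ : ∀ {n} (A B M : Mat n) → (A ⊕ B) · M ≋ A · M ⊕ B · M
·-distribʳ-⊕ {n} A B M i k =
  trans (Σ-cong n (λ m → *-distribʳ-+ (M m k) (A i m) (B i m))) (Σ-distrib-+ n _ _)

·-distribʳ-⊖ : ∀ {n} (A B M : Mat n) → (A ⊖ B) · M ≋ A · M ⊖ B · M
·-distribʳ-⊖ {n} A B M i k =
  trans (Σ-cong n (λ m → distrib (A i m) (B i m) (M m k))) (Σ-distrib-- n _ _)
  where
  distrib : ∀ a b x → (a - b) * x ≡ a * x - b * x
  distrib = solve-∀

·-identityˡ : ∀ {n} (M : Mat n) → Id · M ≋ M
·-identityˡ {n} M i k =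
  trans (Σ-cong n (λ m → cong (_* M m k) (δ-sym i m))) (Σ-δ n i (λ m → M m k))

·-identityʳ : ∀ {n} (M : Mat n) → M · Id ≋ M
·-identityʳ {n} M i k = trans (Σ-cong n (λ m → *-comm (M i m) (δ m k))) (Σ-δ n k (M i))

outer-· : ∀ {n} (u v : Fin n → ℤ) (M : Mat n) → outer u v · M ≋ outer u (v ·ᵣ M)
outer-· {n} u v M i k =
  trans (Σ-cong n (λ m → *-assoc (u i) (v m) (M m k))) (Σ-*ˡ n (u i) (λ m → v m * M m k))

e-·ᵣ : ∀ {n} (j : Fin n) (M : Mat n) → e j ·ᵣ M ≗ M j
e-·ᵣ {n} j M k = Σ-δ n j (λ m → M m k)

·ᵣ-identityʳ : ∀ {n} (v : Fin n → ℤ) → v ·ᵣ Id ≗ v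
·ᵣ-identityʳ {n} v k = trans (Σ-cong n (λ m → *-comm (v m) (δ m k))) (Σ-δ n k v)

·ᵣ-distrib-⊕ : ∀ {n} (v : Fin n → ℤ) (A B : Mat n) → v ·ᵣ (A ⊕ B) ≗ λ k → (v ·ᵣ A) k + (v ·ᵣ B) k
·ᵣ-distrib-⊕ {n} v A B k =
  trans (Σ-cong n (λ m → *-distribˡ-+ (v m) (A m k) (B m k))) (Σ-distrib-+ n _ _)

·ᵣ-distrib-⊖ : ∀ {n} (v : Fin n → ℤ) (A B : Mat n) → v ·ᵣ (A ⊖ B) ≗ λ k → (v ·ᵣ A) k - (v ·ᵣ B) k
·ᵣ-distrib-⊖ {n} v A B k =
  trans (Σ-cong n (λ m → distrib (v m) (A m k) (B m k))) (Σ-distrib-- n _ _)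
  where
  distrib : ∀ x a b → x * (a - b) ≡ x * a - x * b
  distrib = solve-∀

·ᵣ-outer-e : ∀ {n} (v : Fin n → ℤ) (l : Fin n) (w : Fin n → ℤ) →
  v ·ᵣ outer (e l) w ≗ λ k → v l * w k
·ᵣ-outer-e {n} v l w k =
  trans (Σ-cong n (λ m → swap (v m) (δ m l) (w k))) (Σ-δ n l (λ m → v m * w k))
  where
  swap : ∀ x d y → x * (d * y) ≡ d * (x * y)
  swap = solve-∀

K-· : ∀ {n} (j : Fin n) (M : Mat n) → K j · M ≋ M ⊖ outer (e j) (M j) ⊕ outer (e j) (r j ·ᵣ M)
K-· j M i k = begin
  (K j · M) i k
    ≡⟨ ·-distribʳ-⊕ (Id ⊖ outer (e j) (e j)) (outer (e j) (r j)) M i k ⟩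
  ((Id ⊖ outer (e j) (e j)) · M) i k + (outer (e j) (r j) · M) i k
    ≡⟨ cong₂ _+_ (·-distribʳ-⊖ Id (outer (e j) (e j)) M i k) (outer-· (e j) (r j) M i k) ⟩
  (Id · M) i k - (outer (e j) (e j) · M) i k + e j i * (r j ·ᵣ M) k
    ≡⟨ cong (λ x → x + e j i * (r j ·ᵣ M) k)
         (cong₂ _-_ (·-identityˡ M i k) (trans (outer-· (e j) (e j) M i k) (cong (e j i *_) (e-·ᵣ j M k)))) ⟩
  M i k - e j i * M j k + e j i * (r j ·ᵣ M) k
    ∎

sgn-+ : ∀ a b → sgn (a ℕ.+ b) ≡ sgn a * sgn b
sgn-+ zero    b = sym (*-identityˡ (sgn b))
sgn-+ (suc a) b = trans (cong -_ (sgn-+ a b)) (neg-distribˡ-* (sgn a) (sgn b))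

sgn-*-sgn : ∀ a → sgn a * sgn a ≡ + 1
sgn-*-sgn zero    = refl
sgn-*-sgn (suc a) = trans (neg-*-neg (sgn a)) (sgn-*-sgn a)
  where
  neg-*-neg : ∀ x → - x * - x ≡ x * x
  neg-*-neg = solve-∀

sgn-telescope : ∀ a b c → sgn (a ℕ.+ b) * sgn (suc b ℕ.+ c) ≡ - sgn (a ℕ.+ c)
sgn-telescope a b c = begin
  sgn (a ℕ.+ b) * - sgn (b ℕ.+ c)              ≡⟨ cong₂ (λ x y → x * - y) (sgn-+ a b) (sgn-+ b c) ⟩
  sgn a * sgn b * - (sgn b * sgn c)            ≡⟨ regroup (sgn a) (sgn b) (sgn c) ⟩
  - (sgn b * sgn b * (sgn a * sgn c))          ≡⟨ cong (λ x → - (x * (sgn a * sgn c))) (sgn-*-sgn b) ⟩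
  - (+ 1 * (sgn a * sgn c))                    ≡⟨ cong -_ (trans (*-identityˡ _) (sym (sgn-+ a c))) ⟩
  - sgn (a ℕ.+ c)                              ∎
  where
  regroup : ∀ x y z → x * y * - (y * z) ≡ - (y * y * (x * z))
  regroup = solve-∀

r-at : ∀ {n} (j l : Fin n) → r j l ≡ - sgn (pos j ℕ.+ pos l)
r-at j l = begin
  r j l                            ≡⟨ neg-involutive (r j l) ⟨
  - - r j l                        ≡⟨ cong (λ m → - sgn m) (+-suc (pos j) _) ⟨
  - sgn (pos j ℕ.+ pos l)          ∎

r-*-r : ∀ {n} (j l k : Fin n) → r j l * r l k ≡ - r j k
r-*-r j l k = sgn-telescope (pos j) _ _

r-*-sgn : ∀ {n} (j l m : Fin n) → r j l * sgn (pos l ℕ.+ pos m) ≡ - sgn (pos j ℕ.+ pos m)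
r-*-sgn j l m = sgn-telescope (pos j) _ (pos m)

-- The right-hand side of the theorem minus Id, by recursion on the first index
-- (jj a is j_{a+1}).
defect : ∀ {n} t → (Fin (suc t) → Fin n) → Mat n
defect zero    jj = outer (e (jj zero)) (r (jj zero)) ⊖ outer (e (jj zero)) (e (jj zero))
defect (suc t) jj =
  defect t (jj ∘ suc) ⊖ outer (e (jj zero)) (e (jj zero))
    ⊕ outer (e (jj zero)) (λ k → sgn (pos (jj zero) ℕ.+ pos (jj (suc zero))) * e (jj (suc zero)) k)

defect-row-∉ : ∀ {n} t (jj : Fin (suc t) → Fin n) {j : Fin n} → (∀ a → j ≢ jj a) →
  ∀ k → defect t jj j k ≡ + 0
defect-row-∉ zero    jj j∉ k rewrite δ-≢ (j∉ zero) = refl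
defect-row-∉ (suc t) jj j∉ k rewrite δ-≢ (j∉ zero) | defect-row-∉ t (jj ∘ suc) (j∉ ∘ suc) k = refl

r-·ᵣ-defect : ∀ {n} t (jj : Fin (suc t) → Fin n) (j : Fin n) →
  r j ·ᵣ defect t jj ≗ λ k → sgn (pos j ℕ.+ pos (jj zero)) * e (jj zero) k - r j k
r-·ᵣ-defect zero jj j k = begin
  (r j ·ᵣ (outer (e l) (r l) ⊖ outer (e l) (e l))) k
    ≡⟨ ·ᵣ-distrib-⊖ (r j) (outer (e l) (r l)) (outer (e l) (e l)) k ⟩
  (r j ·ᵣ outer (e l) (r l)) k - (r j ·ᵣ outer (e l) (e l)) k
    ≡⟨ cong₂ _-_ (·ᵣ-outer-e (r j) l (r l) k) (·ᵣ-outer-e (r j) l (e l) k) ⟩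
  r j l * r l k - r j l * e l k
    ≡⟨ cong₂ (λ x y → x - y * e l k) (r-*-r j l k) (r-at j l) ⟩
  - r j k - - S * e l k
    ≡⟨ reorder (r j k) S (e l k) ⟩
  S * e l k - r j k
    ∎
  where
  l = jj zero
  S = sgn (pos j ℕ.+ pos l)
  reorder : ∀ x s y → - x - - s * y ≡ s * y - x
  reorder = solve-∀
r-·ᵣ-defect (suc t) jj j k = begin
  (r j ·ᵣ (defect t (jj ∘ suc) ⊖ outer (e l) (e l) ⊕ outer (e l) w)) k
    ≡⟨ ·ᵣ-distrib-⊕ (r j) (defect t (jj ∘ suc) ⊖ outer (e l) (e l)) (outer (e l) w) k ⟩
  (r j ·ᵣ (defect t (jj ∘ suc) ⊖ outer (e l) (e l))) k + (r j ·ᵣ outer (e l) w) k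
    ≡⟨ cong₂ _+_
         (trans (·ᵣ-distrib-⊖ (r j) (defect t (jj ∘ suc)) (outer (e l) (e l)) k)
                (cong₂ _-_ (r-·ᵣ-defect t (jj ∘ suc) j k) (·ᵣ-outer-e (r j) l (e l) k)))
         (trans (·ᵣ-outer-e (r j) l w k) (sym (*-assoc (r j l) s (e l′ k)))) ⟩
  S′ * e l′ k - r j k - r j l * e l k + r j l * s * e l′ k
    ≡⟨ cong₂ (λ x y → S′ * e l′ k - r j k - x * e l k + y * e l′ k) (r-at j l) (r-*-sgn j l l′) ⟩
  S′ * e l′ k - r j k - - S * e l k + - S′ * e l′ k
    ≡⟨ cancel S′ (e l′ k) (r j k) S (e l k) ⟩
  S * e l k - r j k
    ∎
  where
  l = jj zero
  l′ = jj (suc zero)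
  s = sgn (pos l ℕ.+ pos l′)
  w = λ k → s * e l′ k
  S = sgn (pos j ℕ.+ pos l)
  S′ = sgn (pos j ℕ.+ pos l′)
  cancel : ∀ a′ y′ x a y → a′ * y′ - x - - a * y + - a′ * y′ ≡ a * y - x
  cancel = solve-∀

K-·-defect : ∀ {n} t (jj : Fin (suc (suc t)) → Fin n) → (∀ a → jj zero ≢ jj (suc a)) →
  K (jj zero) · (Id ⊕ defect t (jj ∘ suc)) ≋ Id ⊕ defect (suc t) jj
K-·-defect t jj j∉ i k = begin
  (K j · (Id ⊕ T)) i k
    ≡⟨ K-· j (Id ⊕ T) i k ⟩
  δ i k + T i k - e j i * (δ j k + T j k) + e j i * (r j ·ᵣ (Id ⊕ T)) k
    ≡⟨ cong₂ (λ x y → δ i k + T i k - e j i * x + e j i * y) row-j r-row ⟩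
  δ i k + T i k - e j i * (e j k + + 0) + e j i * (r j k + (S * e l′ k - r j k))
    ≡⟨ regroup (δ i k) (T i k) (e j i) (e j k) (r j k) (S * e l′ k) ⟩
  δ i k + (T i k - e j i * e j k + e j i * (S * e l′ k))
    ∎
  where
  j = jj zero
  l′ = jj (suc zero)
  T = defect t (jj ∘ suc)
  S = sgn (pos j ℕ.+ pos l′)
  row-j : δ j k + T j k ≡ e j k + + 0
  row-j = cong₂ _+_ (δ-sym j k) (defect-row-∉ t (jj ∘ suc) j∉ k)
  r-row : (r j ·ᵣ (Id ⊕ T)) k ≡ r j k + (S * e l′ k - r j k)
  r-row = trans (·ᵣ-distrib-⊕ (r j) Id T k)
                (cong₂ _+_ (·ᵣ-identityʳ (r j) k) (r-·ᵣ-defect t (jj ∘ suc) j k))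
  regroup : ∀ d x u v y z → d + x - u * (v + + 0) + u * (y + (z - y)) ≡ d + (x - u * v + u * z)
  regroup = solve-∀

ΠM-K≋Id⊕defect : ∀ {n} t (jj : Fin (suc t) → Fin n) → Injective _≡_ _≡_ jj →
  ΠM (suc t) (λ a → K (jj a)) ≋ Id ⊕ defect t jj
ΠM-K≋Id⊕defect zero jj _ i k = begin
  (K j · Id) i k                              ≡⟨ ·-identityʳ (K j) i k ⟩
  δ i k - e j i * e j k + e j i * r j k       ≡⟨ reorder (δ i k) (e j i * e j k) (e j i * r j k) ⟩
  δ i k + (e j i * r j k - e j i * e j k)     ∎
  where
  j = jj zero
  reorder : ∀ d x y → d - x + y ≡ d + (y - x)
  reorder = solve-∀
ΠM-K≋Id⊕defect (suc t) jj inj i k = begin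
  (K (jj zero) · ΠM (suc t) (λ a → K (jj (suc a)))) i k
    ≡⟨ ·-congˡ (K (jj zero)) (ΠM-K≋Id⊕defect t (jj ∘ suc) (suc-injective ∘ inj)) i k ⟩
  (K (jj zero) · (Id ⊕ defect t (jj ∘ suc))) i k
    ≡⟨ K-·-defect t jj (λ a → 0≢1+n ∘ inj) i k ⟩
  (Id ⊕ defect (suc t) jj) i k
    ∎

succPos-≡ : ∀ {s} {a b : Fin s} → pos b ≡ suc (pos a) → succPos a b ≡ + 1
succPos-≡ {a = a} {b} b≡a+1 with pos b ℕ.≟ suc (pos a)
... | yes _    = refl
... | no  b≢a+1 = ⊥-elim (b≢a+1 b≡a+1)

succPos-≢ : ∀ {s} {a b : Fin s} → pos b ≢ suc (pos a) → succPos a b ≡ + 0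
succPos-≢ {a = a} {b} b≢a+1 with pos b ℕ.≟ suc (pos a)
... | yes b≡a+1 = ⊥-elim (b≢a+1 b≡a+1)
... | no  _     = refl

succPos-suc : ∀ {s} (a b : Fin s) → succPos (suc a) (suc b) ≡ succPos a b
succPos-suc a b = by-cases (pos b ℕ.≟ suc (pos a))
  where
  by-cases : Dec (pos b ≡ suc (pos a)) → succPos (suc a) (suc b) ≡ succPos a b
  by-cases (yes b≡a+1) = trans (succPos-≡ (cong suc b≡a+1)) (sym (succPos-≡ b≡a+1))
  by-cases (no  b≢a+1) = trans (succPos-≢ (b≢a+1 ∘ ℕ-suc-injective)) (sym (succPos-≢ b≢a+1))

pathΣ : ∀ s → (Fin s → Fin s → ℤ) → ℤ
pathΣ s f = Σ s (λ a → Σ s (λ b → succPos a b * f a b))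

pathΣ-suc : ∀ t (f : Fin (suc (suc t)) → Fin (suc (suc t)) → ℤ) →
  pathΣ (suc (suc t)) f ≡ f zero (suc zero) + pathΣ (suc t) (λ a b → f (suc a) (suc b))
pathΣ-suc t f = cong₂ _+_ first-row (Σ-cong (suc t) later-row)
  where
  first-row : + 0 + (+ 1 * f zero (suc zero) + Σ t (λ _ → + 0)) ≡ f zero (suc zero)
  first-row = begin
    + 0 + (+ 1 * f zero (suc zero) + Σ t (λ _ → + 0))  ≡⟨ +-identityˡ _ ⟩
    + 1 * f zero (suc zero) + Σ t (λ _ → + 0)          ≡⟨ cong₂ _+_ (*-identityˡ (f zero (suc zero))) (Σ-zero t) ⟩
    f zero (suc zero) + + 0                             ≡⟨ +-identityʳ _ ⟩
    f zero (suc zero)                                   ∎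
  later-row : ∀ a → + 0 + Σ (suc t) (λ b → succPos (suc a) (suc b) * f (suc a) (suc b))
                  ≡ Σ (suc t) (λ b → succPos a b * f (suc a) (suc b))
  later-row a = trans (+-identityˡ _)
    (Σ-cong (suc t) (λ b → cong (_* f (suc a) (suc b)) (succPos-suc a b)))

closedForm-≋-defect : ∀ {n} t (jj : Fin (suc t) → Fin n) (hs : 1 ≤ suc t) →
  Id ⊖ ΣM (suc t) (λ a → outer (e (jj a)) (e (jj a))) ⊕ Dsum jj
     ⊕ outer (e (jj (lastIx (suc t) hs))) (r (jj (lastIx (suc t) hs)))
    ≋ Id ⊕ defect t jj
-- For a single index, Dsum jj i k computes to + 0 (succPos zero zero does).
closedForm-≋-defect zero jj _ i k = reorder (δ i k) (e j i * e j k) (e j i * r j k)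
  where
  j = jj zero
  reorder : ∀ d x y → d - (x + + 0) + + 0 + y ≡ d + (y - x)
  reorder = solve-∀
closedForm-≋-defect (suc t) jj _ i k = begin
  δ i k - (d₀ + diag′) + pathΣ (suc (suc t)) X + L
    ≡⟨ cong (λ D → δ i k - (d₀ + diag′) + D + L) (pathΣ-suc t X) ⟩
  δ i k - (d₀ + diag′) + (X zero (suc zero) + Dsum (jj ∘ suc) i k) + L
    ≡⟨ regroup (δ i k) d₀ diag′ (X zero (suc zero)) (Dsum (jj ∘ suc) i k) L ⟩
  δ i k - diag′ + Dsum (jj ∘ suc) i k + L - d₀ + X zero (suc zero)
    ≡⟨ cong (λ x → x - d₀ + X zero (suc zero)) (closedForm-≋-defect t (jj ∘ suc) (s≤s z≤n) i k) ⟩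
  δ i k + defect t (jj ∘ suc) i k - d₀ + S * (e j i * e j′ k)
    ≡⟨ reassoc (δ i k) (defect t (jj ∘ suc) i k) d₀ S (e j i) (e j′ k) ⟩
  δ i k + (defect t (jj ∘ suc) i k - d₀ + e j i * (S * e j′ k))
    ∎
  where
  j = jj zero
  j′ = jj (suc zero)
  S = sgn (pos j ℕ.+ pos j′)
  d₀ = e j i * e j k
  diag′ = ΣM (suc t) (λ a → outer (e (jj (suc a))) (e (jj (suc a)))) i k
  X : Fin (suc (suc t)) → Fin (suc (suc t)) → ℤ
  X a b = sgn (pos (jj a) ℕ.+ pos (jj b)) * outer (e (jj a)) (e (jj b)) i k
  L = outer (e (jj (lastIx (suc (suc t)) (s≤s z≤n)))) (r (jj (lastIx (suc (suc t)) (s≤s z≤n)))) i k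
  regroup : ∀ d a g x D l → d - (a + g) + (x + D) + l ≡ d - g + D + l - a + x
  regroup = solve-∀
  reassoc : ∀ d T a s u v → d + T - a + s * (u * v) ≡ d + (T - a + u * (s * v))
  reassoc = solve-∀

theorem2p8 : (s n : ℕ) → (hs : 1 ≤ s) → s ≤ n →
    (jj : Fin s → Fin n) → Injective _≡_ _≡_ jj →
    (i k : Fin n) →
    ΠM s (λ a → K (jj a)) i k
      ≡ (Id ⊖ ΣM s (λ a → outer (e (jj a)) (e (jj a)))
           ⊕ Dsum jj
           ⊕ outer (e (jj (lastIx s hs))) (r (jj (lastIx s hs)))) i k
theorem2p8 (suc t) n hs _ jj inj i k =
  trans (ΠM-K≋Id⊕defect t jj inj i k) (sym (closedForm-≋-defect t jj hs i k))
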